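{- For all integers $n\geq 0$, \[ac_1(n)=\sum_{j=0}^{n-1}ac_0(j),\] where for $n=0$ the empty sum is $0$.
   Context: A composition of $n$ of length $s$ is a sequence $\sigma=(\sigma_1,\ldots,\sigma_s)$ of positive integers with $\sum_i\sigma_i=n$; the empty composition is the unique composition of $0$, of length $0$. A composition is anti-palindromic if $\sigma_i\neq\sigma_{s-i+1}$ for all $i$ with $i\neq\frac{s+1}{2}$ (the empty composition is vacuously anti-palindromic, so $ac_0(0)=1$). $ac_0(n)$ and $ac_1(n)$ are the numbers of anti-palindromic compositions of $n$ of even and odd length, respectively. -}

module Defs where

open import Data.Nat using (ℕ; zero; suc; _+_; _∸_; _≟_; _%_)
open import Data.List using (List; []; _∷_; map; concat; length; filter; upTo)
open import Data.Fin using (Fin; toℕ; opposite)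
open import Data.Fin.Properties using (all?)
open import Data.Vec using (fromList; lookup)
open import Relation.Nullary using (¬_; Dec)
open import Relation.Nullary.Decidable using (¬?; _→-dec_; _×-dec_)
open import Relation.Binary.PropositionalEquality using (_≡_)

-- compsAux f n enumerates all compositions of n (for fuel f ≥ n), each exactly once,
-- by choosing the first part  suc k  with  k ≤ n-1.
compsAux : (fuel : ℕ) → ℕ → List (List ℕ)
compsAux _ zero = [] ∷ []
compsAux zero (suc _) = []
compsAux (suc f) (suc m) =
  concat (map (λ k → map (suc k ∷_) (compsAux f (m ∸ k))) (upTo (suc m)))

compositions : ℕ → List (List ℕ)
compositions n = compsAux n n

-- Anti-palindromic: σ_i ≠ σ_{s-i+1} for all 1-based i with i ≠ (s+1)/2.
-- With 0-based index i : Fin s, the mirror index is  opposite i  (= s-1-i), and the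
-- excluded middle condition (i+1 = (s+1)/2) reads  i + i + 1 = s.
AntiPalindromic : List ℕ → Set
AntiPalindromic σ = (i : Fin (length σ)) → ¬ (toℕ i + toℕ i + 1 ≡ length σ) →
  ¬ (lookup (fromList σ) i ≡ lookup (fromList σ) (opposite i))

antiPalindromic? : (σ : List ℕ) → Dec (AntiPalindromic σ)
antiPalindromic? σ = all? λ i →
  ¬? (toℕ i + toℕ i + 1 ≟ length σ) →-dec ¬? (lookup (fromList σ) i ≟ lookup (fromList σ) (opposite i))

ac₀ : ℕ → ℕ
ac₀ n = length (filter (λ σ → antiPalindromic? σ ×-dec (length σ % 2 ≟ 0)) (compositions n))

ac₁ : ℕ → ℕ
ac₁ n = length (filter (λ σ → antiPalindromic? σ ×-dec (length σ % 2 ≟ 1)) (compositions n))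

sumBelow : ℕ → (ℕ → ℕ) → ℕ
sumBelow zero f = 0
sumBelow (suc n) f = sumBelow n f + f n

-- Inserting a part m in the middle of an even-length composition of j gives an
-- odd-length composition of j + m, and this is a bijection for m ≥ 1: the
-- mirror pairs (σᵢ, σₛ₋ᵢ₊₁) of a ++ b and of a ++ m ∷ b (with |a| = |b|) are
-- the same pairs, namely those of a and b, so anti-palindromicity is preserved
-- in both directions. Grouping the odd anti-palindromic compositions of n by
-- the value j = n - m of the remaining sum gives ac₁(n) = Σ_{j<n} ac₀(j).
module Submission where

open import Defs
open import Data.Nat using (ℕ; zero; suc; _+_; _∸_; _≤_; _<_; _≟_; _%_; ⌊_/2⌋; ⌈_/2⌉; z≤n; s≤s)
open import Data.Nat.Properties
open import Data.Nat.Tactic.RingSolver using (solve-∀)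
open import Data.List using (List; []; _∷_; [_]; _++_; length; map; filter; upTo; take; drop)
open import Data.Nat.ListAction using (sum)
open import Data.Nat.ListAction.Properties using (sum-++)
open import Data.List.Properties
  using (length-++; length-map; map-∘; map-id-local; ∷-injectiveˡ; ∷-injectiveʳ)
open import Data.List.Relation.Unary.Any using (here; there)
open import Data.List.Relation.Unary.All as All using (All; []; _∷_)
import Data.List.Relation.Unary.All.Properties as All
open import Data.List.Relation.Unary.AllPairs as AllPairs using ([]; _∷_)
import Data.List.Relation.Unary.AllPairs.Properties as AllPairs
open import Data.List.Relation.Unary.Unique.Propositional using (Unique)
import Data.List.Relation.Unary.Unique.Propositional.Properties as Unique
open import Data.List.Relation.Binary.Disjoint.Propositional using (Disjoint)
open import Data.List.Relation.Binary.BagAndSetEquality using (∼bag⇒↭)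
open import Data.List.Relation.Binary.Permutation.Propositional.Properties using (↭-length)
open import Data.List.Membership.Propositional using (_∈_)
open import Data.List.Membership.Propositional.Properties
open import Data.List.Membership.Propositional.Properties.WithK using (unique∧set⇒bag)
open import Data.Fin as Fin using (Fin; toℕ; opposite; fromℕ<)
open import Data.Fin.Properties using (toℕ<n; toℕ-fromℕ<; opposite-prop)
open import Data.Vec using (fromList; lookup)
open import Data.Product using (∃; ∃₂; _×_; _,_; proj₁; proj₂)
open import Data.Sum using (inj₁; inj₂)
open import Data.Product.Function.NonDependent.Propositional using (_×-⇔_)
open import Function using (_∘_; const)
open import Function.Bundles using (_⇔_; mk⇔; module Equivalence)
open import Function.Construct.Composition using (_⇔-∘_)
open import Function.Construct.Symmetry using (⇔-sym)
open import Relation.Nullary using (yes; no; contradiction)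
open import Relation.Nullary.Decidable using (_×-dec_)
open import Relation.Binary.PropositionalEquality hiding ([_])

open Equivalence using (to; from)
open ≡-Reasoning

private
  variable
    A : Set
    a b c xs ys : List A
    x y : A
    i n : ℕ

unique∧set⇒length≡ : Unique xs → Unique ys → (∀ {z} → z ∈ xs ⇔ z ∈ ys) →
  length xs ≡ length ys
unique∧set⇒length≡ xs! ys! xs≈ys = ↭-length (∼bag⇒↭ (unique∧set⇒bag xs! ys! xs≈ys))

unique-map⁺-retraction : ∀ {B : Set} {f : A → B} (g : B → A) →
  All (λ x → g (f x) ≡ x) xs → Unique xs → Unique (map f xs)
unique-map⁺-retraction {xs = xs} g g∘f≡id xs! =
  Unique.map⁻ {f = g} (subst Unique (sym (trans (sym (map-∘ xs)) (map-id-local g∘f≡id))) xs!)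

suc[m+n]≡o⇒n≡o∸suc[m] : ∀ m {n o} → suc (m + n) ≡ o → n ≡ o ∸ suc m
suc[m+n]≡o⇒n≡o∸suc[m] m {n} refl = sym (m+n∸m≡n m n)

suc[m+n]≡o⇒m<o : ∀ m {n o} → suc (m + n) ≡ o → m < o
suc[m+n]≡o⇒m<o m {n} refl = s≤s (m≤m+n m n)

suc[m+n]≡o⇒n<o : ∀ m {n o} → suc (m + n) ≡ o → n < o
suc[m+n]≡o⇒n<o m {n} refl = s≤s (m≤n+m n m)

suc[i+j]<m+n : ∀ {i j m n} → i < m → j < n → suc (i + j) < m + n
suc[i+j]<m+n {i} {j} {m} {n} i<m j<n = subst (_≤ m + n) (cong suc (+-suc i j)) (+-mono-≤ i<m j<n)

suc[i+[k+j]]≡k+n⇒suc[i+j]≡n : ∀ i k {j n} → suc (i + (k + j)) ≡ k + n → suc (i + j) ≡ n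
suc[i+[k+j]]≡k+n⇒suc[i+j]≡n i k {j} e = +-cancelˡ-≡ k _ _ (trans (shift i k j) e)
  where
    shift : ∀ i k j → k + suc (i + j) ≡ suc (i + (k + j))
    shift = solve-∀

⌈n+n/2⌉≡n : ∀ n → ⌈ n + n /2⌉ ≡ n
⌈n+n/2⌉≡n zero    = refl
⌈n+n/2⌉≡n (suc n) = cong suc (trans (cong ⌊_/2⌋ (+-suc n n)) (⌈n+n/2⌉≡n n))

[n+n]%2≡0 : ∀ n → (n + n) % 2 ≡ 0
[n+n]%2≡0 zero    = refl
[n+n]%2≡0 (suc n) rewrite +-suc n n = [n+n]%2≡0 n

[1+n+n]%2≡1 : ∀ n → suc (n + n) % 2 ≡ 1
[1+n+n]%2≡1 zero    = refl
[1+n+n]%2≡1 (suc n) rewrite +-suc n n = [1+n+n]%2≡1 n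

split-length : ∀ h k (σ : List A) → length σ ≡ h + k →
  ∃₂ λ a b → σ ≡ a ++ b × length a ≡ h × length b ≡ k
split-length zero    k σ       eq = [] , σ , refl , refl , eq
split-length (suc h) k (x ∷ σ) eq with a , b , refl , la , lb ← split-length h k σ (suc-injective eq) =
  x ∷ a , b , refl , cong suc la , lb

data Parity : ℕ → Set where
  even : ∀ h → Parity (h + h)
  odd  : ∀ h → Parity (suc (h + h))

parity : ∀ n → Parity n
parity zero = even zero
parity (suc n) with parity n
... | even h = odd h
... | odd h  = subst Parity (cong suc (+-suc h h)) (even (suc h))

data Halves {A : Set} : List A → Set where
  even : ∀ a b → length a ≡ length b → Halves (a ++ b)
  odd  : ∀ a m b → length a ≡ length b → Halves (a ++ m ∷ b)

halves-of-parity : (σ : List A) → Parity n → length σ ≡ n → Halves σ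
halves-of-parity σ (even h) eq with a , b , refl , la , lb ← split-length h h σ eq =
  even a b (trans la (sym lb))
halves-of-parity σ (odd h) eq with split-length h (suc h) σ (trans eq (sym (+-suc h h)))
... | a , m ∷ b , refl , la , lb = odd a m b (trans la (sym (suc-injective lb)))

halves : (σ : List A) → Halves σ
halves σ = halves-of-parity σ (parity (length σ)) refl

length-++-halves : ∀ (a b : List A) → length a ≡ length b → length (a ++ b) ≡ length a + length a
length-++-halves a b a≡b = trans (length-++ a) (cong (length a +_) (sym a≡b))

length-++-∷-halves : ∀ (a : List A) x b → length a ≡ length b →
  length (a ++ x ∷ b) ≡ suc (length a + length a)
length-++-∷-halves a x b a≡b =
  trans (length-++ a) (trans (+-suc (length a) _) (cong (λ t → suc (length a + t)) (sym a≡b)))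

length-++-halves-even : ∀ (a b : List A) → length a ≡ length b → length (a ++ b) % 2 ≡ 0
length-++-halves-even a b a≡b = trans (cong (_% 2) (length-++-halves a b a≡b)) ([n+n]%2≡0 (length a))

length-++-∷-halves-odd : ∀ (a : List A) x b → length a ≡ length b → length (a ++ x ∷ b) % 2 ≡ 1
length-++-∷-halves-odd a x b a≡b =
  trans (cong (_% 2) (length-++-∷-halves a x b a≡b)) ([1+n+n]%2≡1 (length a))

even-halves : ∀ (τ : List A) → length τ % 2 ≡ 0 → ∃₂ λ a b → length a ≡ length b × τ ≡ a ++ b
even-halves τ even% with halves τ
... | even a b a≡b  = a , b , a≡b , refl
... | odd a x b a≡b = contradiction (trans (sym even%) (length-++-∷-halves-odd a x b a≡b)) 0≢1+n

odd-halves : ∀ (σ : List A) → length σ % 2 ≡ 1 →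
  ∃₂ λ a b → ∃ λ x → length a ≡ length b × σ ≡ a ++ x ∷ b
odd-halves σ odd% with halves σ
... | odd a x b a≡b = a , b , x , a≡b , refl
... | even a b a≡b  = contradiction (trans (sym (length-++-halves-even a b a≡b)) odd%) 0≢1+n

insertMiddle : A → List A → List A
insertMiddle x τ = take ⌊ length τ /2⌋ τ ++ x ∷ drop ⌊ length τ /2⌋ τ

removeMiddle : List A → List A
removeMiddle σ = take ⌊ length σ /2⌋ σ ++ drop (suc ⌊ length σ /2⌋) σ

take∷drop-length-++ : ∀ (xs : List A) →
  take (length xs) (xs ++ ys) ++ y ∷ drop (length xs) (xs ++ ys) ≡ xs ++ y ∷ ys
take∷drop-length-++ []       = refl
take∷drop-length-++ (x ∷ xs) = cong (x ∷_) (take∷drop-length-++ xs)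

take++drop-suc-length-++ : ∀ (xs : List A) →
  take (length xs) (xs ++ y ∷ ys) ++ drop (suc (length xs)) (xs ++ y ∷ ys) ≡ xs ++ ys
take++drop-suc-length-++ []       = refl
take++drop-suc-length-++ (x ∷ xs) = cong (x ∷_) (take++drop-suc-length-++ xs)

insertMiddle-halves : ∀ (a : List A) x b → length a ≡ length b →
  insertMiddle x (a ++ b) ≡ a ++ x ∷ b
insertMiddle-halves a x b a≡b = begin
  insertMiddle x (a ++ b)
    ≡⟨ cong (λ k → take k (a ++ b) ++ x ∷ drop k (a ++ b)) middle ⟩
  take (length a) (a ++ b) ++ x ∷ drop (length a) (a ++ b)
    ≡⟨ take∷drop-length-++ a ⟩
  a ++ x ∷ b ∎
  where
    middle : ⌊ length (a ++ b) /2⌋ ≡ length a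
    middle = trans (cong ⌊_/2⌋ (length-++-halves a b a≡b)) (sym (n≡⌊n+n/2⌋ (length a)))

removeMiddle-halves : ∀ (a : List A) x b → length a ≡ length b →
  removeMiddle (a ++ x ∷ b) ≡ a ++ b
removeMiddle-halves a x b a≡b = begin
  removeMiddle (a ++ x ∷ b)
    ≡⟨ cong (λ k → take k (a ++ x ∷ b) ++ drop (suc k) (a ++ x ∷ b)) middle ⟩
  take (length a) (a ++ x ∷ b) ++ drop (suc (length a)) (a ++ x ∷ b)
    ≡⟨ take++drop-suc-length-++ a ⟩
  a ++ b ∎
  where
    middle : ⌊ length (a ++ x ∷ b) /2⌋ ≡ length a
    middle = trans (cong ⌊_/2⌋ (length-++-∷-halves a x b a≡b)) (⌈n+n/2⌉≡n (length a))

removeMiddle-insertMiddle : ∀ (τ : List A) → length τ % 2 ≡ 0 → removeMiddle (insertMiddle x τ) ≡ τ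
removeMiddle-insertMiddle {x = x} τ even% with a , b , a≡b , refl ← even-halves τ even% =
  trans (cong removeMiddle (insertMiddle-halves a x b a≡b)) (removeMiddle-halves a x b a≡b)

infix 4 _[_]=_

data _[_]=_ {A : Set} : List A → ℕ → A → Set where
  here  : ∀ {x xs} → (x ∷ xs) [ 0 ]= x
  there : ∀ {x y xs i} → xs [ i ]= y → (x ∷ xs) [ suc i ]= y

[]=-functional : xs [ i ]= x → xs [ i ]= y → x ≡ y
[]=-functional here      here      = refl
[]=-functional (there p) (there q) = []=-functional p q

[]=⇒<length : xs [ i ]= x → i < length xs
[]=⇒<length here      = s≤s z≤n
[]=⇒<length (there p) = s≤s ([]=⇒<length p)

[]=-++ˡ : xs [ i ]= x → xs ++ ys [ i ]= x
[]=-++ˡ here      = here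
[]=-++ˡ (there p) = there ([]=-++ˡ p)

[]=-++ʳ : ∀ xs → ys [ i ]= x → xs ++ ys [ length xs + i ]= x
[]=-++ʳ []       p = p
[]=-++ʳ (_ ∷ xs) p = there ([]=-++ʳ xs p)

data ++-Position {A : Set} (xs ys : List A) : ℕ → A → Set where
  inˡ : ∀ {i x} → xs [ i ]= x → ++-Position xs ys i x
  inʳ : ∀ {i x} → ys [ i ]= x → ++-Position xs ys (length xs + i) x

[]=-++⁻ : ∀ xs → xs ++ ys [ i ]= x → ++-Position xs ys i x
[]=-++⁻ []       p         = inʳ p
[]=-++⁻ (_ ∷ xs) here      = inˡ here
[]=-++⁻ (_ ∷ xs) (there p) with []=-++⁻ xs p
... | inˡ q = inˡ (there q)
... | inʳ q = inʳ q

lookup-[]= : (σ : List A) (k : Fin (length σ)) → σ [ toℕ k ]= lookup (fromList σ) k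
lookup-[]= (x ∷ σ) Fin.zero    = here
lookup-[]= (x ∷ σ) (Fin.suc k) = there (lookup-[]= σ k)

-- AntiPalindromic with ℕ positions: i and j are mirror positions iff i + j + 1 = |σ|,
-- and i = j exactly at the middle of an odd-length list.
AntiPalindromic′ : List A → Set
AntiPalindromic′ σ =
  ∀ {i j x y} → σ [ i ]= x → σ [ j ]= y → suc (i + j) ≡ length σ → i ≢ j → x ≢ y

antiPalindromic⇔antiPalindromic′ : {σ : List ℕ} → AntiPalindromic σ ⇔ AntiPalindromic′ σ
antiPalindromic⇔antiPalindromic′ {σ} = mk⇔ toIndexed fromIndexed
  where
    at : ∀ {t} (k : Fin (length σ)) → toℕ k ≡ t → σ [ t ]= lookup (fromList σ) k
    at k refl = lookup-[]= σ k

    toIndexed : AntiPalindromic σ → AntiPalindromic′ σ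
    toIndexed ap {i} {j} {x} {y} p q mirror i≢j x≡y = ap k notMiddle (begin
      lookup (fromList σ) k            ≡⟨ []=-functional (at k k≡i) p ⟩
      x                                ≡⟨ x≡y ⟩
      y                                ≡⟨ []=-functional q (at (opposite k) opposite≡j) ⟩
      lookup (fromList σ) (opposite k) ∎)
      where
        k = fromℕ< ([]=⇒<length p)
        k≡i : toℕ k ≡ i
        k≡i = toℕ-fromℕ< _
        opposite≡j : toℕ (opposite k) ≡ j
        opposite≡j = trans (opposite-prop k)
          (trans (cong (λ t → length σ ∸ suc t) k≡i) (sym (suc[m+n]≡o⇒n≡o∸suc[m] i mirror)))
        notMiddle : toℕ k + toℕ k + 1 ≢ length σ
        notMiddle middle = i≢j (+-cancelˡ-≡ i i j (suc-injective (begin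
          suc (i + i)   ≡⟨ +-comm 1 (i + i) ⟩
          i + i + 1     ≡⟨ subst (λ t → t + t + 1 ≡ length σ) k≡i middle ⟩
          length σ      ≡⟨ mirror ⟨
          suc (i + j)   ∎)))

    fromIndexed : AntiPalindromic′ σ → AntiPalindromic σ
    fromIndexed ap′ k notMiddle =
      ap′ (at k refl) (at (opposite k) (opposite-prop k)) mirror (λ k≡ → notMiddle (begin
        toℕ k + toℕ k + 1                       ≡⟨ +-comm (toℕ k + toℕ k) 1 ⟩
        suc (toℕ k + toℕ k)                     ≡⟨ cong (λ t → suc (toℕ k + t)) k≡ ⟩
        suc (toℕ k + (length σ ∸ suc (toℕ k))) ≡⟨ mirror ⟩
        length σ                                ∎))
      where
        mirror : suc (toℕ k + (length σ ∸ suc (toℕ k))) ≡ length σ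
        mirror = m+[n∸m]≡n (toℕ<n k)

antiPalindromic′-[] : AntiPalindromic′ {A} []
antiPalindromic′-[] ()

antiPalindromic′-[_] : (x : A) → AntiPalindromic′ [ x ]
antiPalindromic′-[ x ] here       here       _ 0≢0 = contradiction refl 0≢0
antiPalindromic′-[ x ] here       (there ())
antiPalindromic′-[ x ] (there ())

MirrorDistinct : List A → List A → Set
MirrorDistinct a b = ∀ {i j x y} → a [ i ]= x → b [ j ]= y → suc (i + j) ≡ length a → x ≢ y

length-++-++ : ∀ (a c : List A) → length (a ++ c ++ b) ≡ length a + (length c + length b)
length-++-++ a c = trans (length-++ a) (cong (length a +_) (length-++ c))

antiPalindromic′⇒mirrorDistinct : ∀ (a c : List A) {b} → length a ≡ length b →
  AntiPalindromic′ (a ++ c ++ b) → MirrorDistinct a b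
antiPalindromic′⇒mirrorDistinct a c {b} a≡b ap {i} {j} p q mirror =
  ap ([]=-++ˡ p) ([]=-++ʳ a ([]=-++ʳ c q)) total
     (<⇒≢ (<-≤-trans ([]=⇒<length p) (m≤m+n (length a) _)))
  where
    shift : ∀ i h l j → suc (i + (h + (l + j))) ≡ h + (l + suc (i + j))
    shift = solve-∀

    total : suc (i + (length a + (length c + j))) ≡ length (a ++ c ++ b)
    total = begin
      suc (i + (length a + (length c + j))) ≡⟨ shift i (length a) (length c) j ⟩
      length a + (length c + suc (i + j))   ≡⟨ cong (λ t → length a + (length c + t)) (trans mirror a≡b) ⟩
      length a + (length c + length b)      ≡⟨ length-++-++ a c ⟨
      length (a ++ c ++ b)                  ∎

-- A position in a can only be mirrored by one in b, and a position in c only by one in c.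
mirrorDistinct⇒antiPalindromic′ : ∀ (a c : List A) {b} → length a ≡ length b →
  MirrorDistinct a b → AntiPalindromic′ c → AntiPalindromic′ (a ++ c ++ b)
mirrorDistinct⇒antiPalindromic′ a c {b} a≡b distinct apc p q mirror =
  both ([]=-++⁻ a p) ([]=-++⁻ a q) (trans mirror total)
  where
    h = length a
    l = length c

    total : length (a ++ c ++ b) ≡ h + (l + h)
    total = trans (length-++-++ a c) (cong (λ t → h + (l + t)) (sym a≡b))

    outer : ∀ {i j} → a [ i ]= x → c ++ b [ j ]= y → suc (i + (h + j)) ≡ h + (l + h) → x ≢ y
    outer {i = i} {j = j} p q e with []=-++⁻ c q
    ... | inˡ q′ = contradiction (suc[i+[k+j]]≡k+n⇒suc[i+j]≡n i h e)
      (<⇒≢ (subst (suc (i + j) <_) (+-comm h l) (suc[i+j]<m+n ([]=⇒<length p) ([]=⇒<length q′))))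
    ... | inʳ q′ = distinct p q′
      (suc[i+[k+j]]≡k+n⇒suc[i+j]≡n i l (suc[i+[k+j]]≡k+n⇒suc[i+j]≡n i h e))

    inner : ∀ {i j} → c ++ b [ i ]= x → c ++ b [ j ]= y → suc (i + j) ≡ l → i ≢ j → x ≢ y
    inner {i = i} p q e with []=-++⁻ c p | []=-++⁻ c q
    ... | inˡ p′     | inˡ q′     = apc p′ q′ e
    ... | inʳ {i′} _ | _          = contradiction (suc[m+n]≡o⇒m<o (l + i′) e) (m+n≮m l i′)
    ... | inˡ _      | inʳ {j′} _ = contradiction (suc[m+n]≡o⇒n<o i e) (m+n≮m l j′)

    both : ∀ {i j} → ++-Position a (c ++ b) i x → ++-Position a (c ++ b) j y →
      suc (i + j) ≡ h + (l + h) → i ≢ j → x ≢ y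
    both (inˡ p) (inˡ q) e _ = contradiction e
      (<⇒≢ (suc[i+j]<m+n ([]=⇒<length p) (<-≤-trans ([]=⇒<length q) (m≤n+m h l))))
    both (inˡ p) (inʳ q) e _ = outer p q e
    both (inʳ {i} p) (inˡ {j} q) e _ = outer q p (trans (cong suc (+-comm j (h + i))) e) ∘ sym
    both (inʳ {i} p) (inʳ {j} q) e i≢j = inner p q
      (suc[i+[k+j]]≡k+n⇒suc[i+j]≡n i h
        (trans (+-cancelˡ-≡ h _ _ (trans (regroup h i j) e)) (+-comm l h)))
      (i≢j ∘ cong (h +_))
      where
        regroup : ∀ h i j → h + suc (i + (h + j)) ≡ suc (h + i + (h + j))
        regroup = solve-∀

antiPalindromic-insertMiddle : ∀ (a : List ℕ) {b} x → length a ≡ length b →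
  AntiPalindromic (a ++ b) ⇔ AntiPalindromic (a ++ x ∷ b)
antiPalindromic-insertMiddle a {b} x a≡b =
  ⇔-sym antiPalindromic⇔antiPalindromic′ ⇔-∘
    ((⇔-sym (viaMirror [ x ] antiPalindromic′-[ x ]) ⇔-∘ viaMirror [] antiPalindromic′-[])
      ⇔-∘ antiPalindromic⇔antiPalindromic′)
  where
    viaMirror : ∀ c → AntiPalindromic′ c → AntiPalindromic′ (a ++ c ++ b) ⇔ MirrorDistinct a b
    viaMirror c apc = mk⇔ (antiPalindromic′⇒mirrorDistinct a c a≡b)
                          (λ distinct → mirrorDistinct⇒antiPalindromic′ a c a≡b distinct apc)

IsComposition : ℕ → List ℕ → Set
IsComposition n σ = All (0 <_) σ × sum σ ≡ n

compsStartingWith : ℕ → ℕ → ℕ → List (List ℕ)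
compsStartingWith f m k = map (suc k ∷_) (compsAux f (m ∸ k))

∈-compsAux⁻ : ∀ f n {σ} → σ ∈ compsAux f n → IsComposition n σ
∈-compsAux⁻ f       zero    (here refl) = [] , refl
∈-compsAux⁻ (suc f) (suc m) σ∈
  with xs , σ∈xs , xs∈ ← ∈-concat⁻′ (map (compsStartingWith f m) (upTo (suc m))) σ∈
  with k , k∈ , refl ← ∈-map⁻ (compsStartingWith f m) xs∈
  with τ , τ∈ , refl ← ∈-map⁻ _ σ∈xs
  with pos , sum≡ ← ∈-compsAux⁻ f (m ∸ k) τ∈
  = s≤s z≤n ∷ pos , cong suc (trans (cong (k +_) sum≡) (m+[n∸m]≡n (≤-pred (∈-upTo⁻ k∈))))

∈-compsAux⁺ : ∀ f {σ} → All (0 <_) σ → sum σ ≤ f → σ ∈ compsAux f (sum σ)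
∈-compsAux⁺ f       {[]}        []        _          = here refl
∈-compsAux⁺ (suc f) {suc k ∷ τ} (_ ∷ pos) (s≤s sum≤) =
  ∈-concat⁺′ (∈-map⁺ (suc k ∷_) τ∈) (∈-map⁺ _ (∈-upTo⁺ (s≤s (m≤m+n k (sum τ)))))
  where
    τ∈ : τ ∈ compsAux f (k + sum τ ∸ k)
    τ∈ = subst (λ t → τ ∈ compsAux f t) (sym (m+n∸m≡n k (sum τ)))
           (∈-compsAux⁺ f pos (≤-trans (m≤n+m (sum τ) k) sum≤))

compsAux-unique : ∀ f n → Unique (compsAux f n)
compsAux-unique f       zero    = [] ∷ []
compsAux-unique zero    (suc n) = []
compsAux-unique (suc f) (suc m) = Unique.concat⁺
  (All.map⁺ (All.tabulate λ {k} _ → Unique.map⁺ ∷-injectiveʳ (compsAux-unique f (m ∸ k))))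
  (AllPairs.map⁺ {f = compsStartingWith f m} (AllPairs.map differentHeads (Unique.upTo⁺ (suc m))))
  where
    differentHeads : ∀ {k l} → k ≢ l → Disjoint (compsStartingWith f m k) (compsStartingWith f m l)
    differentHeads k≢l (p , q) with _ , _ , refl ← ∈-map⁻ _ p | _ , _ , eq ← ∈-map⁻ _ q =
      k≢l (suc-injective (∷-injectiveˡ eq))

∈-compositions⁻ : {σ : List ℕ} → σ ∈ compositions n → IsComposition n σ
∈-compositions⁻ {n} = ∈-compsAux⁻ n n

∈-compositions⁺ : {σ : List ℕ} → IsComposition n σ → σ ∈ compositions n
∈-compositions⁺ {σ = σ} (pos , refl) = ∈-compsAux⁺ (sum σ) pos ≤-refl

sum-++-∷ : ∀ (a : List ℕ) x b → sum (a ++ x ∷ b) ≡ sum (a ++ b) + x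
sum-++-∷ a x b = begin
  sum (a ++ x ∷ b)    ≡⟨ sum-++ a (x ∷ b) ⟩
  sum a + (x + sum b) ≡⟨ cong (sum a +_) (+-comm x (sum b)) ⟩
  sum a + (sum b + x) ≡⟨ +-assoc (sum a) (sum b) x ⟨
  sum a + sum b + x   ≡⟨ cong (_+ x) (sum-++ a b) ⟨
  sum (a ++ b) + x    ∎

isComposition-insertMiddle : ∀ {j} (a : List ℕ) {b x} → 0 < x →
  IsComposition j (a ++ b) ⇔ IsComposition (j + x) (a ++ x ∷ b)
isComposition-insertMiddle a {b} {x} 0<x = mk⇔
  (λ (pos , sum≡) → All.++⁺ (All.++⁻ˡ a pos) (0<x ∷ All.++⁻ʳ a pos) ,
                    trans (sum-++-∷ a x b) (cong (_+ x) sum≡))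
  (λ (pos , sum≡) → All.++⁺ (All.++⁻ˡ a pos) (All.tail (All.++⁻ʳ a pos)) ,
                    +-cancelʳ-≡ x _ _ (trans (sym (sum-++-∷ a x b)) sum≡))

apComps : ℕ → ℕ → List (List ℕ)
apComps r n = filter (λ σ → antiPalindromic? σ ×-dec (length σ % 2 ≟ r)) (compositions n)

∈-apComps : ∀ r n {σ : List ℕ} →
  σ ∈ apComps r n ⇔ (IsComposition n σ × AntiPalindromic σ × length σ % 2 ≡ r)
∈-apComps r n = mk⇔
  (λ p → let σ∈ , ap , parity≡ = ∈-filter⁻ P? {xs = compositions n} p in
         ∈-compositions⁻ σ∈ , ap , parity≡)
  (λ (isComp , ap , parity≡) → ∈-filter⁺ P? (∈-compositions⁺ isComp) (ap , parity≡))
  where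
    P? = λ (σ : List ℕ) → antiPalindromic? σ ×-dec (length σ % 2 ≟ r)

apComps-unique : ∀ r n → Unique (apComps r n)
apComps-unique r n = Unique.filter⁺ _ (compsAux-unique n n)

∈-apComps-insertMiddle : ∀ j (a : List ℕ) {b x} → length a ≡ length b → 0 < x →
  a ++ b ∈ apComps 0 j ⇔ a ++ x ∷ b ∈ apComps 1 (j + x)
∈-apComps-insertMiddle j a {b} {x} a≡b 0<x =
  ⇔-sym (∈-apComps 1 (j + x)) ⇔-∘
    ((isComposition-insertMiddle a 0<x ×-⇔ (antiPalindromic-insertMiddle a x a≡b ×-⇔ parities))
      ⇔-∘ ∈-apComps 0 j)
  where
    parities : length (a ++ b) % 2 ≡ 0 ⇔ length (a ++ x ∷ b) % 2 ≡ 1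
    parities = mk⇔ (const (length-++-∷-halves-odd a x b a≡b)) (const (length-++-halves-even a b a≡b))

middleInsertions : ℕ → ℕ → List (List ℕ)
middleInsertions n zero    = []
middleInsertions n (suc j) = middleInsertions n j ++ map (insertMiddle (n ∸ j)) (apComps 0 j)

length-middleInsertions : ∀ n k → length (middleInsertions n k) ≡ sumBelow k ac₀
length-middleInsertions n zero    = refl
length-middleInsertions n (suc k) =
  trans (length-++ (middleInsertions n k))
        (cong₂ _+_ (length-middleInsertions n k) (length-map _ (apComps 0 k)))

∈-middleInsertions⁻ : ∀ k {σ} → σ ∈ middleInsertions n k →
  ∃₂ λ j τ → j < k × τ ∈ apComps 0 j × σ ≡ insertMiddle (n ∸ j) τ
∈-middleInsertions⁻ {n} (suc k) σ∈ with ∈-++⁻ (middleInsertions n k) σ∈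
... | inj₁ σ∈′ with j , τ , j<k , τ∈ , σ≡ ← ∈-middleInsertions⁻ k σ∈′ =
  j , τ , m<n⇒m<1+n j<k , τ∈ , σ≡
... | inj₂ σ∈′ with τ , τ∈ , σ≡ ← ∈-map⁻ _ σ∈′ = k , τ , n<1+n k , τ∈ , σ≡

∈-middleInsertions⁺ : ∀ {j} k {τ} → j < k → τ ∈ apComps 0 j →
  insertMiddle (n ∸ j) τ ∈ middleInsertions n k
∈-middleInsertions⁺ {n} {j} (suc k) j<1+k τ∈ with j ≟ k
... | yes refl = ∈-++⁺ʳ (middleInsertions n k) (∈-map⁺ _ τ∈)
... | no j≢k   = ∈-++⁺ˡ (∈-middleInsertions⁺ k (≤∧≢⇒< (≤-pred j<1+k) j≢k) τ∈)

removeMiddle-insertMiddle-apComps : ∀ j {τ} → τ ∈ apComps 0 j → removeMiddle (insertMiddle x τ) ≡ τ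
removeMiddle-insertMiddle-apComps j {τ} τ∈ =
  let _ , _ , even% = to (∈-apComps 0 j) τ∈ in removeMiddle-insertMiddle τ even%

middleInsertions-unique : ∀ n k → Unique (middleInsertions n k)
middleInsertions-unique n zero    = []
middleInsertions-unique n (suc k) = Unique.++⁺
  (middleInsertions-unique n k)
  (unique-map⁺-retraction removeMiddle
    (All.tabulate (removeMiddle-insertMiddle-apComps k)) (apComps-unique 0 k))
  disjoint
  where
    disjoint : Disjoint (middleInsertions n k) (map (insertMiddle (n ∸ k)) (apComps 0 k))
    disjoint (p , q)
      with j , τ , j<k , τ∈ , refl ← ∈-middleInsertions⁻ k p
         | τ′ , τ′∈ , σ≡ ← ∈-map⁻ _ q
      = <⇒≢ j<k (begin
        j       ≡⟨ proj₂ (proj₁ (to (∈-apComps 0 j) τ∈)) ⟨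
        sum τ   ≡⟨ cong sum τ≡τ′ ⟩
        sum τ′  ≡⟨ proj₂ (proj₁ (to (∈-apComps 0 k) τ′∈)) ⟩
        k       ∎)
      where
        τ≡τ′ : τ ≡ τ′
        τ≡τ′ = begin
          τ                                       ≡⟨ removeMiddle-insertMiddle-apComps j τ∈ ⟨
          removeMiddle (insertMiddle (n ∸ j) τ)   ≡⟨ cong removeMiddle σ≡ ⟩
          removeMiddle (insertMiddle (n ∸ k) τ′)  ≡⟨ removeMiddle-insertMiddle-apComps k τ′∈ ⟩
          τ′                                      ∎

apComps₁⊆middleInsertions : ∀ n {σ} → σ ∈ apComps 1 n → σ ∈ middleInsertions n n
apComps₁⊆middleInsertions n {σ} σ∈
  with (pos , sum≡) , _ , odd% ← to (∈-apComps 1 n) σ∈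
  with a , b , x , a≡b , refl ← odd-halves σ odd% =
  subst (_∈ middleInsertions n n) inserted (∈-middleInsertions⁺ n j<n τ∈)
  where
    j = sum (a ++ b)
    0<x : 0 < x
    0<x = All.head (All.++⁻ʳ a pos)
    n≡j+x : n ≡ j + x
    n≡j+x = trans (sym sum≡) (sum-++-∷ a x b)
    j<n : j < n
    j<n = subst (j <_) (sym n≡j+x) (m<m+n j 0<x)
    τ∈ : a ++ b ∈ apComps 0 j
    τ∈ = from (∈-apComps-insertMiddle j a a≡b 0<x)
              (subst (λ t → a ++ x ∷ b ∈ apComps 1 t) n≡j+x σ∈)
    inserted : insertMiddle (n ∸ j) (a ++ b) ≡ a ++ x ∷ b
    inserted = trans (cong (λ t → insertMiddle t (a ++ b)) (trans (cong (_∸ j) n≡j+x) (m+n∸m≡n j x)))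
                     (insertMiddle-halves a x b a≡b)

middleInsertions⊆apComps₁ : ∀ n {σ} → σ ∈ middleInsertions n n → σ ∈ apComps 1 n
middleInsertions⊆apComps₁ n σ∈
  with j , τ , j<n , τ∈ , refl ← ∈-middleInsertions⁻ n σ∈
  with _ , _ , even% ← to (∈-apComps 0 j) τ∈
  with a , b , a≡b , refl ← even-halves τ even% =
  subst (_∈ apComps 1 n) (sym (insertMiddle-halves a (n ∸ j) b a≡b))
    (subst (λ t → a ++ n ∸ j ∷ b ∈ apComps 1 t) (m+[n∸m]≡n (<⇒≤ j<n))
      (to (∈-apComps-insertMiddle j a a≡b (m<n⇒0<n∸m j<n)) τ∈))

proposition5 : (n : ℕ) → ac₁ n ≡ sumBelow n ac₀
proposition5 n = begin
  ac₁ n                         ≡⟨ unique∧set⇒length≡ (apComps-unique 1 n) (middleInsertions-unique n n)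
                                     (mk⇔ (apComps₁⊆middleInsertions n) (middleInsertions⊆apComps₁ n)) ⟩
  length (middleInsertions n n) ≡⟨ length-middleInsertions n n ⟩
  sumBelow n ac₀                ∎
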